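{- Let $r \ge \frac52$ be a half-integer or integer and let $D$ be a digraph of order $n=2r+1$ and radius $r$. Then $\lvert A(D)\rvert \le (2r+1)(r+1)-1 = \lvert A(\overline{\Gamma}_{2r+1})\rvert$, and equality holds if and only if $D$ is isomorphic to $\overline{\Gamma}_{2r+1}$.
   Context: Digraphs are finite, without loops or multiple arcs. $d(u,v)$ is the length of a shortest directed path from $u$ to $v$ ($+\infty$ if none). For a vertex $x$, $d(x,V)=\max_u d(x,u)$ and $d(V,x)=\max_u d(u,x)$. The radius of a digraph is $\mathrm{rad}(D)=\min_{x}\frac{d(x,V)+d(V,x)}{2}$. For $d\ge 1$, $\overline{\Gamma}_{d+1}$ is the digraph with vertex set $\{v_0,\dots,v_d\}$ and arc set $\{\vec{v_iv_j}: i\ne j,\ i\ge j-1\}$ (a transitive tournament together with the path $v_0v_1\dots v_d$). -}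

module Defs where

open import Data.Nat using (ℕ; zero; suc; _+_; _*_; _≤_; _<_)
open import Data.Fin using (Fin; toℕ)
open import Data.Bool using (Bool; true; false; if_then_else_)
open import Data.List using (List; map; allFin)
open import Data.Nat.ListAction using (sum)
open import Data.Product using (Σ; ∃; ∃-syntax; _×_; _,_)
open import Relation.Binary.PropositionalEquality using (_≡_)
open import Relation.Nullary using (¬_)
open import Function.Bundles using (_↔_; Inverse)
open import Data.Nat using (_≤ᵇ_)
open import Data.Fin using (_≟_)
open import Relation.Nullary.Decidable using (⌊_⌋)

record Digraph (n : ℕ) : Set where
  field
    adj       : Fin n → Fin n → Bool
    loopless  : ∀ u → adj u u ≡ false
open Digraph public

arcs : ∀ {n} → Digraph n → ℕ
arcs {n} D = sum (map (λ u → sum (map (λ v → if adj D u v then 1 else 0) (allFin n))) (allFin n))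

data Walk {n : ℕ} (D : Digraph n) : Fin n → Fin n → ℕ → Set where
  here : ∀ {u} → Walk D u u 0
  step : ∀ {u w v m} → adj D u w ≡ true → Walk D w v m → Walk D u v (suc m)

IsDist : ∀ {n} → Digraph n → Fin n → Fin n → ℕ → Set
IsDist D u v m = Walk D u v m × (∀ k → k < m → ¬ Walk D u v k)

OutEcc : ∀ {n} → Digraph n → Fin n → ℕ → Set
OutEcc D x a = (∀ u → ∃[ m ] (m ≤ a × IsDist D x u m)) × (∃[ u ] IsDist D x u a)

InEcc : ∀ {n} → Digraph n → Fin n → ℕ → Set
InEcc D x b = (∀ u → ∃[ m ] (m ≤ b × IsDist D u x m)) × (∃[ u ] IsDist D u x b)

-- 2·rad(D) = k, i.e. min_x (d(x,V)+d(V,x)) = k (vertices with an infinite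
-- eccentricity contribute +∞ and so never attain a finite minimum).
TwiceRadius : ∀ {n} → Digraph n → ℕ → Set
TwiceRadius {n} D k =
  (∃[ x ] ∃[ a ] ∃[ b ] (OutEcc D x a × InEcc D x b × a + b ≡ k))
  × (∀ y a b → OutEcc D y a → InEcc D y b → k ≤ a + b)

GammaBar : (d : ℕ) → Digraph (suc d)
GammaBar d = record
  { adj = λ i j → if ⌊ i ≟ j ⌋ then false else (toℕ j ≤ᵇ suc (toℕ i))
  ; loopless = λ u → lem u }
  where
  open import Relation.Nullary using (yes; no)
  open import Relation.Binary.PropositionalEquality using (refl)
  open import Data.Empty using (⊥-elim)
  lem : ∀ u → (if ⌊ u ≟ u ⌋ then false else (toℕ u ≤ᵇ suc (toℕ u))) ≡ false
  lem u with u ≟ u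
  ... | yes _ = refl
  ... | no ¬p = ⊥-elim (¬p refl)

_≅_ : ∀ {n} → Digraph n → Digraph n → Set
_≅_ {n} D E = Σ (Fin n ↔ Fin n) λ f → ∀ u v → adj D u v ≡ adj E (Inverse.to f u) (Inverse.to f v)

-- For a vertex v let nonOutDeg v (nonInDeg v) count the vertices u ≠ v with no arc v → u
-- (u → v). The spheres around v of radii 2, …, d(v,V) are nonempty and consist of such
-- vertices, so d(v,V) ≤ 1 + nonOutDeg v, and dually d(V,v) ≤ 1 + nonInDeg v. The radius
-- hypothesis therefore makes excess v = nonOutDeg v + nonInDeg v + 2 − k a natural number,
-- and double counting gives Σ excess + 2|A(D)| = (k + 1)(k + 2): the bound says Σ excess ≥ 2.
-- If d(x,y) = 3 + t, then y and all its in-neighbours lie at distance ≥ 2 + t from x, which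
-- yields excess x + excess y ≥ 3 + t + d(V,x) + d(y,V) − k. For a diametral pair this gives
-- Σ excess ≥ 1, hence ≥ 2 by parity. When Σ excess = 2, the same inequality applied to
-- suitable further vertices forces the diameter to be k (diameter k − 1 is refuted in D or in
-- the reverse digraph), so some geodesic passes through all k + 1 vertices. Numbering the
-- vertices along it embeds D arc by arc into Γ̄_{k+1}, and equal arc counts make the
-- embedding an isomorphism.

module Submission where

open import Defs
open import Data.Nat using (ℕ; zero; suc; _+_; _*_; _∸_; _≤_; _<_; z≤n; s≤s; s≤s⁻¹; _⊔_; _⊓_; _≤?_; _≟_)
open import Data.Nat.Properties
open import Relation.Binary.Definitions using (tri<; tri≈; tri>)
open import Data.Fin using (Fin; zero; suc; toℕ; punchOut; inject₁; fromℕ) renaming (_≟_ to _≟ᶠ_)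
import Data.Fin.Properties as Fin
open import Data.Bool using (Bool; true; false; if_then_else_; not)
import Data.Bool.Properties as Bool
open import Data.List using (List; []; _∷_; map; allFin; tabulate)
open import Data.List.Properties using (map-tabulate)
open import Data.List.Relation.Unary.All using (All; []; _∷_)
open import Data.List.Relation.Unary.AllPairs using (AllPairs; []; _∷_)
import Data.Nat.ListAction as List
open import Data.Vec.Functional using (updateAt)
open import Data.Vec.Functional.Properties using (updateAt-updates; updateAt-minimal)
open import Data.Product using (∃; ∃-syntax; _×_; _,_; proj₁; proj₂)
open import Data.Sum using (inj₁; inj₂; [_,_]′)
open import Data.Empty using (⊥; ⊥-elim)
open import Relation.Nullary using (¬_; Dec; yes; no; does)
open import Relation.Nullary.Decidable using (_×-dec_; decidable-stable)
open import Relation.Binary.PropositionalEquality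
open import Function using (_∘_; const)
open import Function.Bundles using (_⇔_; mk⇔; _↔_; Inverse; mk↔ₛ′; Equivalence)
open import Function.Properties.Inverse using (↔-sym)
open import Function.Definitions using (Injective)
open import Algebra.Properties.CommutativeMonoid.Sum +-0-commutativeMonoid
  using (sum; ∑-comm; ∑-permute; ∑-distrib-+; sum-cong-≗; sum-init-last)
open import Algebra.Properties.CommutativeSemigroup +-commutativeSemigroup using (x∙yz≈y∙xz)
open import Data.Nat.Solver using (module +-*-Solver)
open +-*-Solver using (solve; _:+_; _:*_; _:=_; con)

χ : Bool → ℕ
χ b = if b then 1 else 0

𝟙 : ∀ {p} {P : Set p} → Dec P → ℕ
𝟙 (yes _) = 1
𝟙 (no _) = 0

𝟙-yes : ∀ {p} {P : Set p} (P? : Dec P) → P → 𝟙 P? ≡ 1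
𝟙-yes (yes _) _ = refl
𝟙-yes (no ¬p) p = ⊥-elim (¬p p)

𝟙-no : ∀ {p} {P : Set p} (P? : Dec P) → ¬ P → 𝟙 P? ≡ 0
𝟙-no (yes p) ¬p = ⊥-elim (¬p p)
𝟙-no (no _) _ = refl

𝟙≡χ-does : ∀ {p} {P : Set p} (P? : Dec P) → 𝟙 P? ≡ χ (does P?)
𝟙≡χ-does (yes _) = refl
𝟙≡χ-does (no _) = refl

true≢false : ¬ true ≡ false
true≢false ()

χ-injective : ∀ {a b} → χ a ≡ χ b → a ≡ b
χ-injective {true} {true} _ = refl
χ-injective {false} {false} _ = refl

χ-mono : ∀ {a b} → (a ≡ true → b ≡ true) → χ a ≤ χ b
χ-mono {false} _ = z≤n
χ-mono {true} a⇒b rewrite a⇒b refl = ≤-refl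

+-mono-≤-≡⇒≡ : ∀ {a b c d} → a ≤ b → c ≤ d → a + c ≡ b + d → a ≡ b × c ≡ d
+-mono-≤-≡⇒≡ {a} {b} {c} {d} a≤b c≤d e = ≤-antisym a≤b b≤a , ≤-antisym c≤d d≤c
  where
  b≤a : b ≤ a
  b≤a = +-cancelʳ-≤ c b a (≤-trans (+-monoʳ-≤ b c≤d) (≤-reflexive (sym e)))
  d≤c : d ≤ c
  d≤c = +-cancelˡ-≤ a d c (≤-trans (+-monoˡ-≤ d a≤b) (≤-reflexive (sym e)))

sum-mono-≤ : ∀ {n} {f g : Fin n → ℕ} → (∀ i → f i ≤ g i) → sum f ≤ sum g
sum-mono-≤ {zero} f≤g = z≤n
sum-mono-≤ {suc n} f≤g = +-mono-≤ (f≤g zero) (sum-mono-≤ (f≤g ∘ suc))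

sum-mono-≤-≡⇒≗ : ∀ {n} {f g : Fin n → ℕ} → (∀ i → f i ≤ g i) → sum f ≡ sum g → ∀ i → f i ≡ g i
sum-mono-≤-≡⇒≗ {suc n} f≤g e zero = proj₁ (+-mono-≤-≡⇒≡ (f≤g zero) (sum-mono-≤ (f≤g ∘ suc)) e)
sum-mono-≤-≡⇒≗ {suc n} f≤g e (suc i) =
  sum-mono-≤-≡⇒≗ (f≤g ∘ suc) (proj₂ (+-mono-≤-≡⇒≡ (f≤g zero) (sum-mono-≤ (f≤g ∘ suc)) e)) i

sum-const : ∀ n c → sum {n} (const c) ≡ n * c
sum-const zero c = refl
sum-const (suc n) c = cong (c +_) (sum-const n c)

sum-updateAt-0 : ∀ {n} (f : Fin n → ℕ) i → sum f ≡ f i + sum (updateAt f i (const 0))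
sum-updateAt-0 f zero = refl
sum-updateAt-0 f (suc i) =
  trans (cong (f zero +_) (sum-updateAt-0 (f ∘ suc) i)) (x∙yz≈y∙xz (f zero) (f (suc i)) _)

≤-sum : ∀ {n} (f : Fin n → ℕ) i → f i ≤ sum f
≤-sum f i = subst (f i ≤_) (sym (sum-updateAt-0 f i)) (m≤m+n _ _)

sum-indicator : ∀ {n} (i : Fin n) → sum (λ j → 𝟙 (j ≟ᶠ i)) ≡ 1
sum-indicator {suc n} i = begin
    sum (λ j → 𝟙 (j ≟ᶠ i))
  ≡⟨ sum-updateAt-0 (λ j → 𝟙 (j ≟ᶠ i)) i ⟩
    𝟙 (i ≟ᶠ i) + sum (updateAt (λ j → 𝟙 (j ≟ᶠ i)) i (const 0))
  ≡⟨ cong₂ _+_ (𝟙-yes (i ≟ᶠ i) refl) (sum-cong-≗ vanishes) ⟩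
    1 + sum {suc n} (const 0)
  ≡⟨ cong suc (trans (sum-const (suc n) 0) (*-zeroʳ n)) ⟩
    1
  ∎
  where
  open ≡-Reasoning
  vanishes : ∀ j → updateAt (λ j → 𝟙 (j ≟ᶠ i)) i (const 0) j ≡ 0
  vanishes j with j ≟ᶠ i
  ... | yes refl = updateAt-updates i _
  ... | no j≢i = trans (updateAt-minimal j i _ j≢i) (𝟙-no (j ≟ᶠ i) j≢i)

Distinct : ∀ {n} → List (Fin n) → Set
Distinct = AllPairs (λ i j → ¬ i ≡ j)

sum-distinct≤sum : ∀ {n} (f : Fin n → ℕ) (is : List (Fin n)) → Distinct is → List.sum (map f is) ≤ sum f
sum-distinct≤sum f [] [] = z≤n
sum-distinct≤sum {n} f (i ∷ is) (i∉is ∷ distinct) =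
  subst (f i + List.sum (map f is) ≤_) (sym (sum-updateAt-0 f i))
    (+-monoʳ-≤ (f i) (subst (λ l → List.sum l ≤ sum f′) (untouched is i∉is) (sum-distinct≤sum f′ is distinct)))
  where
  f′ : Fin n → ℕ
  f′ = updateAt f i (const 0)
  untouched : ∀ js → All (λ j → ¬ i ≡ j) js → map f′ js ≡ map f js
  untouched [] [] = refl
  untouched (j ∷ js) (i≢j ∷ p) = cong₂ _∷_ (updateAt-minimal j i f (i≢j ∘ sym)) (untouched js p)

two≤sum : ∀ {n} (f : Fin n → ℕ) {x y} → ¬ x ≡ y → f x + f y ≤ sum f
two≤sum f {x} {y} x≢y =
  subst (_≤ sum f) (cong (f x +_) (+-identityʳ (f y))) (sum-distinct≤sum f (x ∷ y ∷ []) ((x≢y ∷ []) ∷ [] ∷ []))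

three≤sum : ∀ {n} (f : Fin n → ℕ) {x y z} → ¬ x ≡ y → ¬ x ≡ z → ¬ y ≡ z → f x + f y + f z ≤ sum f
three≤sum f {x} {y} {z} x≢y x≢z y≢z =
  subst (_≤ sum f) (solve 3 (λ a b c → a :+ (b :+ (c :+ con 0)) := a :+ b :+ c) refl (f x) (f y) (f z))
    (sum-distinct≤sum f (x ∷ y ∷ z ∷ []) ((x≢y ∷ x≢z ∷ []) ∷ (y≢z ∷ []) ∷ [] ∷ []))

four≤sum : ∀ {n} (f : Fin n → ℕ) {x y z w} → ¬ x ≡ y → ¬ x ≡ z → ¬ x ≡ w → ¬ y ≡ z → ¬ y ≡ w → ¬ z ≡ w →
           f x + f y + f z + f w ≤ sum f
four≤sum f {x} {y} {z} {w} x≢y x≢z x≢w y≢z y≢w z≢w =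
  subst (_≤ sum f) (solve 4 (λ a b c d → a :+ (b :+ (c :+ (d :+ con 0))) := a :+ b :+ c :+ d) refl (f x) (f y) (f z) (f w))
    (sum-distinct≤sum f (x ∷ y ∷ z ∷ w ∷ []) ((x≢y ∷ x≢z ∷ x≢w ∷ []) ∷ (y≢z ∷ y≢w ∷ []) ∷ (z≢w ∷ []) ∷ [] ∷ []))

max : ∀ {n} → (Fin n → ℕ) → ℕ
max {zero} f = 0
max {suc n} f = f zero ⊔ max (f ∘ suc)

≤-max : ∀ {n} (f : Fin n → ℕ) i → f i ≤ max f
≤-max f zero = m≤m⊔n _ _
≤-max f (suc i) = ≤-trans (≤-max (f ∘ suc) i) (m≤n⊔m _ _)

max-lub : ∀ {n} (f : Fin n → ℕ) {c} → (∀ i → f i ≤ c) → max f ≤ c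
max-lub {zero} f f≤c = z≤n
max-lub {suc n} f f≤c = ⊔-lub (f≤c zero) (max-lub (f ∘ suc) (f≤c ∘ suc))

max-attained : ∀ {n} (f : Fin (suc n) → ℕ) → ∃[ i ] (f i ≡ max f)
max-attained {zero} f = zero , sym (⊔-identityʳ _)
max-attained {suc n} f with ⊔-sel (f zero) (max (f ∘ suc))
... | inj₁ e = zero , sym e
... | inj₂ e with max-attained (f ∘ suc)
...   | i , fi≡max = suc i , trans fi≡max (sym e)

module LeastWitness {p} {P : ℕ → Set p} (P? : ∀ m → Dec (P m)) where

  Least : ℕ → Set p
  Least m = P m × (∀ j → j < m → ¬ P j)

  private
    search : ∀ fuel i → (∀ j → j < i → ¬ P j) → P (i + fuel) → ∃ Least
    search fuel i below with P? i
    ... | yes Pi = λ _ → i , Pi , below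
    search zero i below | no ¬Pi = ⊥-elim ∘ ¬Pi ∘ subst P (+-identityʳ i)
    search (suc fuel) i below | no ¬Pi = search fuel (suc i) below′ ∘ subst P (+-suc i fuel)
      where
      below′ : ∀ j → j < suc i → ¬ P j
      below′ j j<1+i with m≤n⇒m<n∨m≡n (s≤s⁻¹ j<1+i)
      ... | inj₁ j<i = below j j<i
      ... | inj₂ refl = ¬Pi

  least : ∀ {m} → P m → ∃ Least
  least {m} = search m 0 (λ _ ())

reverse : ∀ {n} → Digraph n → Digraph n
reverse D = record { adj = λ u v → adj D v u ; loopless = loopless D }

sum-tabulate : ∀ {n} (f : Fin n → ℕ) → List.sum (tabulate f) ≡ sum f
sum-tabulate {zero} f = refl
sum-tabulate {suc n} f = cong (f zero +_) (sum-tabulate (f ∘ suc))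

sum-allFin : ∀ {n} (f : Fin n → ℕ) → List.sum (map f (allFin n)) ≡ sum f
sum-allFin f = trans (cong List.sum (map-tabulate (λ i → i) f)) (sum-tabulate f)

nonOutNeighbour : ∀ {k} → Digraph (suc k) → Fin (suc k) → Fin (suc k) → ℕ
nonOutNeighbour D v u with u ≟ᶠ v
... | yes _ = 0
... | no _ = χ (not (adj D v u))

outdeg nonOutDeg indeg nonInDeg : ∀ {k} → Digraph (suc k) → Fin (suc k) → ℕ
outdeg D v = sum (χ ∘ adj D v)
nonOutDeg D v = sum (nonOutNeighbour D v)
indeg D = outdeg (reverse D)
nonInDeg D = nonOutDeg (reverse D)

arcs≡sum∑ : ∀ {n} (D : Digraph n) → arcs D ≡ sum (λ u → sum (χ ∘ adj D u))
arcs≡sum∑ {n} D = trans (sum-allFin (λ u → List.sum (map (χ ∘ adj D u) (allFin n)))) (sum-cong-≗ λ u → sum-allFin (χ ∘ adj D u))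

arcs≡sum-outdeg : ∀ {k} (D : Digraph (suc k)) → arcs D ≡ sum (outdeg D)
arcs≡sum-outdeg = arcs≡sum∑

arcs≡sum-indeg : ∀ {k} (D : Digraph (suc k)) → arcs D ≡ sum (indeg D)
arcs≡sum-indeg D = trans (arcs≡sum-outdeg D) (∑-comm (λ u v → χ (adj D u v)))

nonOutDeg+outdeg≡k : ∀ {k} (D : Digraph (suc k)) v → nonOutDeg D v + outdeg D v ≡ k
nonOutDeg+outdeg≡k {k} D v = begin
    nonOutDeg D v + outdeg D v
  ≡⟨ sym (∑-distrib-+ (nonOutNeighbour D v) (χ ∘ adj D v)) ⟩
    sum (λ u → nonOutNeighbour D v u + χ (adj D v u))
  ≡⟨ sum-cong-≗ pointwise ⟩
    sum (updateAt (const 1) v (const 0))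
  ≡⟨ suc-injective (trans (sym (sum-updateAt-0 (const 1) v)) (trans (sum-const (suc k) 1) (*-identityʳ _))) ⟩
    k
  ∎
  where
  open ≡-Reasoning
  pointwise : ∀ u → nonOutNeighbour D v u + χ (adj D v u) ≡ updateAt (const 1) v (const 0) u
  pointwise u with u ≟ᶠ v
  ... | yes refl = trans (cong χ (loopless D u)) (sym (updateAt-updates u (const 1)))
  ... | no u≢v = trans (lemma (adj D v u)) (sym (updateAt-minimal u v (const 1) u≢v))
    where
    lemma : ∀ b → χ (not b) + χ b ≡ 1
    lemma true = refl
    lemma false = refl

nonInDeg+indeg≡k : ∀ {k} (D : Digraph (suc k)) v → nonInDeg D v + indeg D v ≡ k
nonInDeg+indeg≡k D = nonOutDeg+outdeg≡k (reverse D)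

sum-nonDeg+2arcs : ∀ {k} (D : Digraph (suc k)) →
  sum (λ v → nonOutDeg D v + nonInDeg D v) + (arcs D + arcs D) ≡ suc k * k + suc k * k
sum-nonDeg+2arcs {k} D = begin
    sum (λ v → nonOutDeg D v + nonInDeg D v) + (arcs D + arcs D)
  ≡⟨ cong₂ _+_ (∑-distrib-+ (nonOutDeg D) (nonInDeg D)) (cong₂ _+_ (arcs≡sum-outdeg D) (arcs≡sum-indeg D)) ⟩
    (sum (nonOutDeg D) + sum (nonInDeg D)) + (sum (outdeg D) + sum (indeg D))
  ≡⟨ +-comm-middle (sum (nonOutDeg D)) (sum (nonInDeg D)) (sum (outdeg D)) (sum (indeg D)) ⟩
    (sum (nonOutDeg D) + sum (outdeg D)) + (sum (nonInDeg D) + sum (indeg D))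
  ≡⟨ cong₂ _+_ (sym (∑-distrib-+ (nonOutDeg D) (outdeg D))) (sym (∑-distrib-+ (nonInDeg D) (indeg D))) ⟩
    sum (λ v → nonOutDeg D v + outdeg D v) + sum (λ v → nonInDeg D v + indeg D v)
  ≡⟨ cong₂ _+_ (degree-sum (nonOutDeg+outdeg≡k D)) (degree-sum (nonInDeg+indeg≡k D)) ⟩
    suc k * k + suc k * k
  ∎
  where
  open ≡-Reasoning
  +-comm-middle : ∀ a b c d → (a + b) + (c + d) ≡ (a + c) + (b + d)
  +-comm-middle = solve 4 (λ a b c d → (a :+ b) :+ (c :+ d) := (a :+ c) :+ (b :+ d)) refl
  degree-sum : {f : Fin (suc k) → ℕ} → (∀ v → f v ≡ k) → sum f ≡ suc k * k
  degree-sum f≡k = trans (sum-cong-≗ f≡k) (sum-const (suc k) k)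

StronglyConnected : ∀ {n} → Digraph n → Set
StronglyConnected {n} D = ∀ u v → ∃[ m ] Walk D u v m

module Walks {n} (D : Digraph n) where

  _++ʷ_ : ∀ {u v w m m′} → Walk D u v m → Walk D v w m′ → Walk D u w (m + m′)
  here ++ʷ q = q
  step a p ++ʷ q = step a (p ++ʷ q)

  splitWalk : ∀ j {r u v} → Walk D u v (j + r) → ∃[ q ] (Walk D u q j × Walk D q v r)
  splitWalk zero p = _ , here , p
  splitWalk (suc j) (step a p) with splitWalk j p
  ... | q , p₁ , p₂ = q , step a p₁ , p₂

  walk? : ∀ m u v → Dec (Walk D u v m)
  walk? zero u v with u ≟ᶠ v
  ... | yes refl = yes here
  ... | no u≢v = no λ { here → u≢v refl }
  walk? (suc m) u v with Fin.any? (λ w → (adj D u w Bool.≟ true) ×-dec walk? m w v)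
  ... | yes (w , a , p) = yes (step a p)
  ... | no ∄w = no λ { (step {w = w} a p) → ∄w (w , a , p) }

walk-reverse : ∀ {n} {D : Digraph n} {u v m} → Walk D u v m → Walk (reverse D) v u m
walk-reverse here = here
walk-reverse (step a p) = snoc (walk-reverse p) a
  where
  snoc : ∀ {n} {E : Digraph n} {u v w m} → Walk E u v m → adj E v w ≡ true → Walk E u w (suc m)
  snoc here b = step b here
  snoc (step c q) b = step c (snoc q b)

reverse-stronglyConnected : ∀ {n} {D : Digraph n} → StronglyConnected D → StronglyConnected (reverse D)
reverse-stronglyConnected conn u v = proj₁ (conn v u) , walk-reverse (proj₂ (conn v u))

twiceRadius⇒stronglyConnected : ∀ {n} {D : Digraph n} {r} → TwiceRadius D r → StronglyConnected D
twiceRadius⇒stronglyConnected {D = D} ((_ , _ , _ , (from-centre , _) , (to-centre , _) , _) , _) u v =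
  _ , Walks._++ʷ_ D (proj₁ (proj₂ (proj₂ (to-centre u)))) (proj₁ (proj₂ (proj₂ (from-centre v))))

module Distances {k} (D : Digraph (suc k)) (conn : StronglyConnected D) where
  open Walks D

  private
    shortest : ∀ u v → ∃ (LeastWitness.Least (λ m → walk? m u v))
    shortest u v = LeastWitness.least (λ m → walk? m u v) (proj₂ (conn u v))

  opaque
    dist : Fin (suc k) → Fin (suc k) → ℕ
    dist u v = proj₁ (shortest u v)

    dist-walk : ∀ u v → Walk D u v (dist u v)
    dist-walk u v = proj₁ (proj₂ (shortest u v))

    dist-minimal : ∀ u v j → j < dist u v → ¬ Walk D u v j
    dist-minimal u v = proj₂ (proj₂ (shortest u v))

  dist-≤-walk : ∀ {u v m} → Walk D u v m → dist u v ≤ m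
  dist-≤-walk {u} {v} {m} p = ≮⇒≥ λ m<d → dist-minimal u v m m<d p

  dist-isDist : ∀ u v → IsDist D u v (dist u v)
  dist-isDist u v = dist-walk u v , dist-minimal u v

  isDist⇒≡dist : ∀ {u v m} → IsDist D u v m → m ≡ dist u v
  isDist⇒≡dist {u} {v} (p , minimal) = ≤-antisym (≮⇒≥ λ d<m → minimal _ d<m (dist-walk u v)) (dist-≤-walk p)

  dist-triangle : ∀ u v w → dist u w ≤ dist u v + dist v w
  dist-triangle u v w = dist-≤-walk (dist-walk u v ++ʷ dist-walk v w)

  dist-refl : ∀ u → dist u u ≡ 0
  dist-refl u = n≤0⇒n≡0 (dist-≤-walk {u} here)

  dist≡0⇒≡ : ∀ {u v} → dist u v ≡ 0 → u ≡ v
  dist≡0⇒≡ {u} {v} e with dist u v | dist-walk u v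
  dist≡0⇒≡ refl | .0 | here = refl

  ≢⇒1≤dist : ∀ {u v} → ¬ u ≡ v → 1 ≤ dist u v
  ≢⇒1≤dist {u} {v} u≢v = n≢0⇒n>0 (u≢v ∘ dist≡0⇒≡)

  adj⇒dist≤1 : ∀ {u v} → adj D u v ≡ true → dist u v ≤ 1
  adj⇒dist≤1 a = dist-≤-walk (step a here)

  dist≡1⇒adj : ∀ {u v} → dist u v ≡ 1 → adj D u v ≡ true
  dist≡1⇒adj {u} {v} e with dist u v | dist-walk u v
  dist≡1⇒adj refl | .1 | step a here = a

  dist-split : ∀ {u v} j r → j + r ≡ dist u v → ∃[ q ] (dist u q ≡ j × dist q v ≡ r)
  dist-split {u} {v} j r e with splitWalk j (subst (Walk D u v) (sym e) (dist-walk u v))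
  ... | q , p₁ , p₂ = q , ≤-antisym (dist-≤-walk p₁) j≤ , ≤-antisym (dist-≤-walk p₂) r≤
    where
    j+r≤ : j + r ≤ dist u q + dist q v
    j+r≤ = subst (_≤ dist u q + dist q v) (sym e) (dist-triangle u q v)
    j≤ : j ≤ dist u q
    j≤ = ≮⇒≥ λ lt → <⇒≱ (+-mono-<-≤ lt (dist-≤-walk p₂)) j+r≤
    r≤ : r ≤ dist q v
    r≤ = ≮⇒≥ λ lt → <⇒≱ (+-mono-≤-< (dist-≤-walk p₁) lt) j+r≤

  opaque
    outEcc inEcc : Fin (suc k) → ℕ
    outEcc v = max (dist v)
    inEcc v = max (λ u → dist u v)

    dist≤outEcc : ∀ v u → dist v u ≤ outEcc v
    dist≤outEcc v = ≤-max (dist v)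

    dist≤inEcc : ∀ v u → dist u v ≤ inEcc v
    dist≤inEcc v = ≤-max (λ u → dist u v)

    outEcc-lub : ∀ v {c} → (∀ u → dist v u ≤ c) → outEcc v ≤ c
    outEcc-lub v = max-lub (dist v)

    inEcc-lub : ∀ v {c} → (∀ u → dist u v ≤ c) → inEcc v ≤ c
    inEcc-lub v = max-lub (λ u → dist u v)

    outEcc-attained : ∀ v → ∃[ u ] (dist v u ≡ outEcc v)
    outEcc-attained v = max-attained (dist v)

    inEcc-attained : ∀ v → ∃[ u ] (dist u v ≡ inEcc v)
    inEcc-attained v = max-attained (λ u → dist u v)

  inEcc≤1⇒adj : ∀ {v} → inEcc v ≤ 1 → ∀ {u} → ¬ u ≡ v → adj D u v ≡ true
  inEcc≤1⇒adj {v} in≤1 {u} u≢v = dist≡1⇒adj (≤-antisym (≤-trans (dist≤inEcc v u) in≤1) (≢⇒1≤dist u≢v))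

  inEcc≤1⇒nonInDeg≡0 : ∀ {v} → inEcc v ≤ 1 → nonInDeg D v ≡ 0
  inEcc≤1⇒nonInDeg≡0 {v} in≤1 = trans (sum-cong-≗ pointwise) (trans (sum-const (suc k) 0) (*-zeroʳ (suc k)))
    where
    pointwise : ∀ u → nonOutNeighbour (reverse D) v u ≡ 0
    pointwise u with u ≟ᶠ v
    ... | yes _ = refl
    ... | no u≢v = cong (χ ∘ not) (inEcc≤1⇒adj in≤1 u≢v)

  outEcc-OutEcc : ∀ v → OutEcc D v (outEcc v)
  outEcc-OutEcc v with outEcc-attained v
  ... | u , e = (λ w → dist v w , dist≤outEcc v w , dist-isDist v w) , u , subst (IsDist D v u) e (dist-isDist v u)

  inEcc-InEcc : ∀ v → InEcc D v (inEcc v)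
  inEcc-InEcc v with inEcc-attained v
  ... | u , e = (λ w → dist w v , dist≤inEcc v w , dist-isDist w v) , u , subst (λ m → IsDist D u v m) e (dist-isDist u v)

  twiceRadius⇒≤outEcc+inEcc : ∀ {r} → TwiceRadius D r → ∀ v → r ≤ outEcc v + inEcc v
  twiceRadius⇒≤outEcc+inEcc (_ , minimal) v = minimal v _ _ (outEcc-OutEcc v) (inEcc-InEcc v)

  opaque
    diam : ℕ
    diam = max outEcc

    outEcc≤diam : ∀ v → outEcc v ≤ diam
    outEcc≤diam = ≤-max outEcc

    diam-attained : ∃[ x ] ∃[ y ] (dist x y ≡ diam)
    diam-attained with max-attained outEcc
    ... | x , ex with outEcc-attained x
    ...   | y , ey = x , y , trans ey ex

  dist≤diam : ∀ u v → dist u v ≤ diam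
  dist≤diam u v = ≤-trans (dist≤outEcc u v) (outEcc≤diam u)

  inEcc≤diam : ∀ v → inEcc v ≤ diam
  inEcc≤diam v = inEcc-lub v (λ u → dist≤diam u v)

𝟙-≤-split : ∀ j d → 𝟙 (j ≤? d) ≡ 𝟙 (d ≟ j) + 𝟙 (suc j ≤? d)
𝟙-≤-split j d with <-cmp j d
... | tri< j<d j≢d _ = trans (𝟙-yes (j ≤? d) (<⇒≤ j<d)) (sym (cong₂ _+_ (𝟙-no (d ≟ j) (j≢d ∘ sym)) (𝟙-yes (suc j ≤? d) j<d)))
... | tri≈ _ refl _ = trans (𝟙-yes (j ≤? j) ≤-refl) (sym (cong₂ _+_ (𝟙-yes (j ≟ j) refl) (𝟙-no (suc j ≤? j) (n≮n j))))
... | tri> _ j≢d d<j = trans (𝟙-no (j ≤? d) (<⇒≱ d<j)) (sym (cong₂ _+_ (𝟙-no (d ≟ j) (j≢d ∘ sym)) (𝟙-no (suc j ≤? d) (<⇒≱ (m<n⇒m<1+n d<j)))))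

module Layers {k} (D : Digraph (suc k)) (conn : StronglyConnected D) where
  open Distances D conn

  farOut sphereOut : Fin (suc k) → ℕ → ℕ
  farOut v j = sum (λ u → 𝟙 (j ≤? dist v u))
  sphereOut v j = sum (λ u → 𝟙 (dist v u ≟ j))

  farOut-suc : ∀ v j → farOut v j ≡ sphereOut v j + farOut v (suc j)
  farOut-suc v j = trans (sum-cong-≗ λ u → 𝟙-≤-split j (dist v u)) (∑-distrib-+ (λ u → 𝟙 (dist v u ≟ j)) (λ u → 𝟙 (suc j ≤? dist v u)))

  sphereOut-nonempty : ∀ v {j} → j ≤ outEcc v → 1 ≤ sphereOut v j
  sphereOut-nonempty v {j} j≤ecc with outEcc-attained v
  ... | u , du with dist-split {v} {u} j (outEcc v ∸ j) (trans (m+[n∸m]≡n j≤ecc) (sym du))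
  ...   | q , dq , _ = subst (_≤ sphereOut v j) (𝟙-yes (dist v q ≟ j) dq) (≤-sum (λ u → 𝟙 (dist v u ≟ j)) q)

  farOut-nonempty : ∀ v {j} → j ≤ outEcc v → 1 ≤ farOut v j
  farOut-nonempty v {j} j≤ecc = ≤-trans (sphereOut-nonempty v j≤ecc) (≤-trans (m≤m+n _ _) (≤-reflexive (sym (farOut-suc v j))))

  farOut-drop : ∀ v t j → j + t ≤ suc (outEcc v) → t + farOut v (j + t) ≤ farOut v j
  farOut-drop v zero j _ = ≤-reflexive (cong (farOut v) (+-identityʳ j))
  farOut-drop v (suc t) j j+t<ecc = begin
      suc t + farOut v (j + suc t)
    ≡⟨ cong (λ i → suc t + farOut v i) (+-suc j t) ⟩
      suc (t + farOut v (suc j + t))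
    ≤⟨ +-mono-≤ (sphereOut-nonempty v j≤ecc) (farOut-drop v t (suc j) (≤-trans (≤-reflexive (sym (+-suc j t))) j+t<ecc)) ⟩
      sphereOut v j + farOut v (suc j)
    ≡⟨ sym (farOut-suc v j) ⟩
      farOut v j
    ∎
    where
    open ≤-Reasoning
    j≤ecc : j ≤ outEcc v
    j≤ecc = s≤s⁻¹ (≤-trans (s≤s (m≤m+n j t)) (≤-trans (≤-reflexive (sym (+-suc j t))) j+t<ecc))

  farOut-2≤nonOutDeg : ∀ v → farOut v 2 ≤ nonOutDeg D v
  farOut-2≤nonOutDeg v = sum-mono-≤ pointwise
    where
    pointwise : ∀ u → 𝟙 (2 ≤? dist v u) ≤ nonOutNeighbour D v u
    pointwise u with 2 ≤? dist v u
    ... | no _ = z≤n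
    ... | yes 2≤d with u ≟ᶠ v
    ...   | yes refl = ⊥-elim (<⇒≱ 2≤d (≤-trans (≤-reflexive (dist-refl u)) z≤n))
    ...   | no _ with adj D v u in a
    ...     | true = ⊥-elim (<⇒≱ 2≤d (adj⇒dist≤1 a))
    ...     | false = ≤-refl

  farOut-below-outEcc : ∀ v t j → j + t ≡ outEcc v → suc t ≤ farOut v j
  farOut-below-outEcc v t j e = begin
    suc t                 ≡⟨ +-comm 1 t ⟩
    t + 1                 ≤⟨ +-monoʳ-≤ t (farOut-nonempty v (≤-reflexive e)) ⟩
    t + farOut v (j + t)  ≤⟨ farOut-drop v t j (≤-trans (≤-reflexive e) (n≤1+n _)) ⟩
    farOut v j            ∎
    where open ≤-Reasoning

  outEcc≤1+nonOutDeg : ∀ v → outEcc v ≤ suc (nonOutDeg D v)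
  outEcc≤1+nonOutDeg v with outEcc v in e
  ... | zero = z≤n
  ... | suc zero = s≤s z≤n
  ... | suc (suc t) = s≤s (≤-trans (farOut-below-outEcc v t 2 (sym e)) (farOut-2≤nonOutDeg v))

  nonOutDeg+nonInDeg-far : ∀ x y t → dist x y ≡ 3 + t → t + 1 + k ≤ nonOutDeg D x + nonInDeg D y
  nonOutDeg+nonInDeg-far x y t dxy = begin
      t + 1 + k
    ≡⟨ cong (t + 1 +_) (sym (nonInDeg+indeg≡k D y)) ⟩
      t + 1 + (nonInDeg D y + indeg D y)
    ≡⟨ solve 4 (λ t a b c → t :+ a :+ (b :+ c) := (t :+ (a :+ c)) :+ b) refl t 1 (nonInDeg D y) (indeg D y) ⟩
      t + (1 + indeg D y) + nonInDeg D y
    ≤⟨ +-monoˡ-≤ (nonInDeg D y) (+-monoʳ-≤ t y-and-in-neighbours) ⟩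
      t + farOut x (2 + t) + nonInDeg D y
    ≤⟨ +-monoˡ-≤ (nonInDeg D y) (farOut-drop x t 2 (≤-trans (n≤1+n _) (≤-trans (≤-reflexive (sym dxy)) (≤-trans (dist≤outEcc x y) (n≤1+n _))))) ⟩
      farOut x 2 + nonInDeg D y
    ≤⟨ +-monoˡ-≤ (nonInDeg D y) (farOut-2≤nonOutDeg x) ⟩
      nonOutDeg D x + nonInDeg D y
    ∎
    where
    open ≤-Reasoning
    pointwise : ∀ u → 𝟙 (u ≟ᶠ y) + χ (adj D u y) ≤ 𝟙 (2 + t ≤? dist x u)
    pointwise u with u ≟ᶠ y
    ... | yes refl = ≤-reflexive (trans (cong (λ b → 1 + χ b) (loopless D u))
                       (sym (𝟙-yes (2 + t ≤? dist x u) (≤-trans (n≤1+n _) (≤-reflexive (sym dxy))))))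
    ... | no _ with adj D u y in a
    ...   | false = z≤n
    ...   | true = ≤-reflexive (sym (𝟙-yes (2 + t ≤? dist x u) (s≤s⁻¹ (begin
              3 + t                  ≡⟨ sym dxy ⟩
              dist x y               ≤⟨ dist-triangle x u y ⟩
              dist x u + dist u y    ≤⟨ +-monoʳ-≤ (dist x u) (adj⇒dist≤1 a) ⟩
              dist x u + 1           ≡⟨ +-comm (dist x u) 1 ⟩
              suc (dist x u)         ∎))))
    y-and-in-neighbours : 1 + indeg D y ≤ farOut x (2 + t)
    y-and-in-neighbours = begin
      1 + indeg D y                                              ≡⟨ cong (_+ indeg D y) (sym (sum-indicator y)) ⟩
      sum (λ u → 𝟙 (u ≟ᶠ y)) + sum (λ u → χ (adj D u y))          ≡⟨ sym (∑-distrib-+ (λ u → 𝟙 (u ≟ᶠ y)) (λ u → χ (adj D u y))) ⟩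
      sum (λ u → 𝟙 (u ≟ᶠ y) + χ (adj D u y))                      ≤⟨ sum-mono-≤ pointwise ⟩
      farOut x (2 + t)                                           ∎

module Reversal {k} (D : Digraph (suc k)) (conn : StronglyConnected D) where
  open Distances D conn
  module R = Distances (reverse D) (reverse-stronglyConnected conn)

  dist-reverse : ∀ u v → R.dist u v ≡ dist v u
  dist-reverse u v = sym (R.isDist⇒≡dist (walk-reverse (dist-walk v u) , λ j j<d p → dist-minimal v u j j<d (walk-reverse p)))

  outEcc-reverse : ∀ v → R.outEcc v ≡ inEcc v
  outEcc-reverse v = ≤-antisym (R.outEcc-lub v λ u → ≤-trans (≤-reflexive (dist-reverse v u)) (dist≤inEcc v u))
                               (inEcc-lub v λ u → ≤-trans (≤-reflexive (sym (dist-reverse v u))) (R.dist≤outEcc v u))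

  inEcc-reverse : ∀ v → R.inEcc v ≡ outEcc v
  inEcc-reverse v = ≤-antisym (R.inEcc-lub v λ u → ≤-trans (≤-reflexive (dist-reverse u v)) (dist≤outEcc v u))
                              (outEcc-lub v λ u → ≤-trans (≤-reflexive (sym (dist-reverse u v))) (R.dist≤inEcc v u))

  inEcc≤1+nonInDeg : ∀ v → inEcc v ≤ suc (nonInDeg D v)
  inEcc≤1+nonInDeg v = subst (_≤ suc (nonInDeg D v)) (outEcc-reverse v)
    (Layers.outEcc≤1+nonOutDeg (reverse D) (reverse-stronglyConnected conn) v)

consecutive-product-even : ∀ k → ∃[ t ] ((k + 1) * (k + 2) ≡ 2 * t)
consecutive-product-even zero = 1 , refl
consecutive-product-even (suc k) with consecutive-product-even k
... | t , e = t + (2 + k) , (begin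
    (suc k + 1) * (suc k + 2)      ≡⟨ solve 1 (λ k → (con 1 :+ k :+ con 1) :* (con 1 :+ k :+ con 2) := (k :+ con 1) :* (k :+ con 2) :+ con 2 :* (con 2 :+ k)) refl k ⟩
    (k + 1) * (k + 2) + 2 * (2 + k) ≡⟨ cong (_+ 2 * (2 + k)) e ⟩
    2 * t + 2 * (2 + k)            ≡⟨ sym (*-distribˡ-+ 2 t (2 + k)) ⟩
    2 * (t + (2 + k))              ∎)
  where open ≡-Reasoning

module Excess {k} (D : Digraph (suc k)) (conn : StronglyConnected D)
              (rad : ∀ v → k ≤ Distances.outEcc D conn v + Distances.inEcc D conn v) where
  open Distances D conn
  open Layers D conn using (outEcc≤1+nonOutDeg; nonOutDeg+nonInDeg-far)
  open Reversal D conn using (inEcc≤1+nonInDeg)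

  nonDeg : Fin (suc k) → ℕ
  nonDeg v = nonOutDeg D v + nonInDeg D v

  k≤nonDeg+2 : ∀ v → k ≤ nonDeg v + 2
  k≤nonDeg+2 v = begin
    k                                                 ≤⟨ rad v ⟩
    outEcc v + inEcc v                                ≤⟨ +-mono-≤ (outEcc≤1+nonOutDeg v) (inEcc≤1+nonInDeg v) ⟩
    suc (nonOutDeg D v) + suc (nonInDeg D v)          ≡⟨ solve 2 (λ a b → (con 1 :+ a) :+ (con 1 :+ b) := (a :+ b) :+ con 2) refl (nonOutDeg D v) (nonInDeg D v) ⟩
    nonDeg v + 2                                      ∎
    where open ≤-Reasoning

  excess : Fin (suc k) → ℕ
  excess v = nonDeg v + 2 ∸ k

  excess+k : ∀ v → excess v + k ≡ nonDeg v + 2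
  excess+k v = m∸n+n≡m (k≤nonDeg+2 v)

  excess-far-pair : ∀ x y t → dist x y ≡ 3 + t → 3 + t + inEcc x + outEcc y ≤ excess x + excess y + k
  excess-far-pair x y t dxy = +-cancelʳ-≤ k _ _ (begin
      3 + t + inEcc x + outEcc y + k
    ≤⟨ +-monoˡ-≤ k (+-mono-≤ (+-monoʳ-≤ (3 + t) (inEcc≤1+nonInDeg x)) (outEcc≤1+nonOutDeg y)) ⟩
      3 + t + suc (nonInDeg D x) + suc (nonOutDeg D y) + k
    ≡⟨ solve 4 (λ t a b k → con 3 :+ t :+ (con 1 :+ a) :+ (con 1 :+ b) :+ k := (t :+ con 1 :+ k) :+ (a :+ b :+ con 4))
         refl t (nonInDeg D x) (nonOutDeg D y) k ⟩
      (t + 1 + k) + (nonInDeg D x + nonOutDeg D y + 4)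
    ≤⟨ +-monoˡ-≤ _ (nonOutDeg+nonInDeg-far x y t dxy) ⟩
      (nonOutDeg D x + nonInDeg D y) + (nonInDeg D x + nonOutDeg D y + 4)
    ≡⟨ solve 4 (λ a b c d → (a :+ b) :+ (c :+ d :+ con 4) := (a :+ c :+ con 2) :+ (d :+ b :+ con 2))
         refl (nonOutDeg D x) (nonInDeg D y) (nonInDeg D x) (nonOutDeg D y) ⟩
      (nonDeg x + 2) + (nonDeg y + 2)
    ≡⟨ cong₂ _+_ (sym (excess+k x)) (sym (excess+k y)) ⟩
      (excess x + k) + (excess y + k)
    ≡⟨ solve 3 (λ a b k → (a :+ k) :+ (b :+ k) := a :+ b :+ k :+ k) refl (excess x) (excess y) k ⟩
      excess x + excess y + k + k
    ∎)
    where open ≤-Reasoning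

  sum-excess+2arcs : sum excess + 2 * arcs D ≡ (k + 1) * (k + 2)
  sum-excess+2arcs = +-cancelʳ-≡ (suc k * k) _ _ (begin
      sum excess + 2 * arcs D + suc k * k
    ≡⟨ solve 3 (λ a b c → a :+ con 2 :* b :+ c := (a :+ c) :+ (b :+ b)) refl (sum excess) (arcs D) (suc k * k) ⟩
      (sum excess + suc k * k) + (arcs D + arcs D)
    ≡⟨ cong (λ z → (sum excess + z) + (arcs D + arcs D)) (sym (sum-const (suc k) k)) ⟩
      (sum excess + sum {suc k} (const k)) + (arcs D + arcs D)
    ≡⟨ cong (_+ (arcs D + arcs D)) (sym (∑-distrib-+ excess (const k))) ⟩
      sum (λ v → excess v + k) + (arcs D + arcs D)
    ≡⟨ cong (_+ (arcs D + arcs D)) (trans (sum-cong-≗ excess+k) (∑-distrib-+ nonDeg (const 2))) ⟩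
      (sum nonDeg + sum {suc k} (const 2)) + (arcs D + arcs D)
    ≡⟨ solve 3 (λ a b c → (a :+ b) :+ c := (a :+ c) :+ b) refl (sum nonDeg) (sum {suc k} (const 2)) (arcs D + arcs D) ⟩
      (sum nonDeg + (arcs D + arcs D)) + sum {suc k} (const 2)
    ≡⟨ cong₂ _+_ (sum-nonDeg+2arcs D) (sum-const (suc k) 2) ⟩
      (suc k * k + suc k * k) + suc k * 2
    ≡⟨ solve 1 (λ k → ((con 1 :+ k) :* k :+ (con 1 :+ k) :* k) :+ (con 1 :+ k) :* con 2 := (k :+ con 1) :* (k :+ con 2) :+ (con 1 :+ k) :* k) refl k ⟩
      (k + 1) * (k + 2) + suc k * k
    ∎)
    where open ≡-Reasoning

  sum-excess≢1 : ¬ sum excess ≡ 1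
  sum-excess≢1 e with consecutive-product-even k
  ... | t , even = even≢odd t (arcs D) (trans (sym even) (trans (sym sum-excess+2arcs) (cong (_+ 2 * arcs D) e)))

  arcs-tight⇒sum-excess≡2 : 2 * (arcs D + 1) ≡ (k + 1) * (k + 2) → sum excess ≡ 2
  arcs-tight⇒sum-excess≡2 tight = +-cancelʳ-≡ (2 * arcs D) _ _ (begin
    sum excess + 2 * arcs D       ≡⟨ sum-excess+2arcs ⟩
    (k + 1) * (k + 2)             ≡⟨ sym tight ⟩
    2 * (arcs D + 1)              ≡⟨ solve 1 (λ a → con 2 :* (a :+ con 1) := con 2 :+ con 2 :* a) refl (arcs D) ⟩
    2 + 2 * arcs D                ∎)
    where open ≡-Reasoning

  inEcc≤excess-far : ∀ u v t → dist u v ≡ 3 + t → inEcc v ≡ 3 + t → inEcc u ≤ excess u + excess v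
  inEcc≤excess-far u v t duv ev = +-cancelˡ-≤ k _ _ (begin
      k + inEcc u                          ≤⟨ +-monoˡ-≤ (inEcc u) (rad v) ⟩
      outEcc v + inEcc v + inEcc u         ≡⟨ cong (λ z → outEcc v + z + inEcc u) ev ⟩
      outEcc v + (3 + t) + inEcc u         ≡⟨ solve 3 (λ a b t → a :+ (con 3 :+ t) :+ b := con 3 :+ t :+ b :+ a) refl (outEcc v) (inEcc u) t ⟩
      3 + t + inEcc u + outEcc v           ≤⟨ excess-far-pair u v t duv ⟩
      excess u + excess v + k              ≡⟨ +-comm _ k ⟩
      k + (excess u + excess v)            ∎)
    where open ≤-Reasoning

  outEcc≤excess-far : ∀ u v t → dist u v ≡ 3 + t → outEcc u ≡ 3 + t → outEcc v ≤ excess u + excess v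
  outEcc≤excess-far u v t duv eu = +-cancelˡ-≤ k _ _ (begin
      k + outEcc v                         ≤⟨ +-monoˡ-≤ (outEcc v) (rad u) ⟩
      outEcc u + inEcc u + outEcc v        ≡⟨ cong (λ z → z + inEcc u + outEcc v) eu ⟩
      3 + t + inEcc u + outEcc v           ≤⟨ excess-far-pair u v t duv ⟩
      excess u + excess v + k              ≡⟨ +-comm _ k ⟩
      k + (excess u + excess v)            ∎)
    where open ≤-Reasoning

other-vertex : ∀ {n} (v : Fin (suc (suc n))) → ∃[ u ] ¬ u ≡ v
other-vertex zero = suc zero , λ ()
other-vertex (suc _) = zero , λ ()

module LargeRadius {s} (D : Digraph (6 + s)) (conn : StronglyConnected D)
                   (rad : ∀ v → 5 + s ≤ Distances.outEcc D conn v + Distances.inEcc D conn v) where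
  open Distances D conn public
  open Excess D conn rad public
  open Layers D conn using (farOut-suc; farOut-below-outEcc; farOut-2≤nonOutDeg)

  1≤outEcc : ∀ v → 1 ≤ outEcc v
  1≤outEcc v with other-vertex v
  ... | u , u≢v = ≤-trans (≢⇒1≤dist (u≢v ∘ sym)) (dist≤outEcc v u)

  1≤inEcc : ∀ v → 1 ≤ inEcc v
  1≤inEcc v with other-vertex v
  ... | u , u≢v = ≤-trans (≢⇒1≤dist u≢v) (dist≤inEcc v u)

  x₀ y₀ : Fin (6 + s)
  x₀ = proj₁ diam-attained
  y₀ = proj₁ (proj₂ diam-attained)

  dist-x₀y₀ : dist x₀ y₀ ≡ diam
  dist-x₀y₀ = proj₂ (proj₂ diam-attained)

  outEcc-x₀ : outEcc x₀ ≡ diam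
  outEcc-x₀ = ≤-antisym (outEcc≤diam x₀) (≤-trans (≤-reflexive (sym dist-x₀y₀)) (dist≤outEcc x₀ y₀))

  3≤diam : 3 ≤ diam
  3≤diam = ≮⇒≥ λ diam<3 → <⇒≱ (s≤s (+-mono-≤ (s≤s⁻¹ diam<3) (s≤s⁻¹ diam<3)))
    (≤-trans (m≤m+n 5 s) (≤-trans (rad x₀) (+-mono-≤ (outEcc≤diam x₀) (inEcc≤diam x₀))))

  diam≡3+ : diam ≡ 3 + (diam ∸ 3)
  diam≡3+ = sym (m+[n∸m]≡n 3≤diam)

  x₀≢y₀ : ¬ x₀ ≡ y₀
  x₀≢y₀ e = <⇒≱ 3≤diam (≤-trans (≤-reflexive (trans (sym dist-x₀y₀) (trans (cong (dist x₀) (sym e)) (dist-refl x₀)))) z≤n)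

  excess-diam-pair : diam + inEcc x₀ + outEcc y₀ ≤ excess x₀ + excess y₀ + (5 + s)
  excess-diam-pair = subst (λ d → d + inEcc x₀ + outEcc y₀ ≤ excess x₀ + excess y₀ + (5 + s)) (sym diam≡3+)
    (excess-far-pair x₀ y₀ (diam ∸ 3) (trans dist-x₀y₀ diam≡3+))

  5+s≤diam+inEcc-x₀ : 5 + s ≤ diam + inEcc x₀
  5+s≤diam+inEcc-x₀ = ≤-trans (rad x₀) (≤-reflexive (cong (_+ inEcc x₀) outEcc-x₀))

  1≤excess-x₀+excess-y₀ : 1 ≤ excess x₀ + excess y₀
  1≤excess-x₀+excess-y₀ = +-cancelˡ-≤ (5 + s) _ _ (begin
    5 + s + 1                              ≤⟨ +-mono-≤ 5+s≤diam+inEcc-x₀ (1≤outEcc y₀) ⟩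
    diam + inEcc x₀ + outEcc y₀            ≤⟨ excess-diam-pair ⟩
    excess x₀ + excess y₀ + (5 + s)        ≡⟨ +-comm _ (5 + s) ⟩
    5 + s + (excess x₀ + excess y₀)        ∎)
    where open ≤-Reasoning

  2≤sum-excess : 2 ≤ sum excess
  2≤sum-excess = ≤∧≢⇒< (≤-trans 1≤excess-x₀+excess-y₀ (two≤sum excess x₀≢y₀)) (sum-excess≢1 ∘ sym)

  arcs-bound : 2 * (arcs D + 1) ≤ (5 + s + 1) * (5 + s + 2)
  arcs-bound = begin
    2 * (arcs D + 1)          ≡⟨ solve 1 (λ a → con 2 :* (a :+ con 1) := con 2 :+ con 2 :* a) refl (arcs D) ⟩
    2 + 2 * arcs D            ≤⟨ +-monoˡ-≤ (2 * arcs D) 2≤sum-excess ⟩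
    sum excess + 2 * arcs D   ≡⟨ sum-excess+2arcs ⟩
    (5 + s + 1) * (5 + s + 2) ∎
    where open ≤-Reasoning

  module Tight (sum≡2 : sum excess ≡ 2) where

    excess-pair≤2 : ∀ {u v} → ¬ u ≡ v → excess u + excess v ≤ 2
    excess-pair≤2 u≢v = ≤-trans (two≤sum excess u≢v) (≤-reflexive sum≡2)

    diam≤k : diam ≤ 5 + s
    diam≤k = +-cancelʳ-≤ 2 diam (5 + s) (begin
      diam + 2                             ≤⟨ +-monoʳ-≤ diam (+-mono-≤ (1≤inEcc x₀) (1≤outEcc y₀)) ⟩
      diam + (inEcc x₀ + outEcc y₀)        ≡⟨ sym (+-assoc diam _ _) ⟩
      diam + inEcc x₀ + outEcc y₀          ≤⟨ excess-diam-pair ⟩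
      excess x₀ + excess y₀ + (5 + s)      ≤⟨ +-monoˡ-≤ (5 + s) (excess-pair≤2 x₀≢y₀) ⟩
      2 + (5 + s)                          ≡⟨ +-comm 2 (5 + s) ⟩
      5 + s + 2                            ∎)
      where open ≤-Reasoning

    module ShortDiameter (diam<k : diam < 5 + s) where
      t : ℕ
      t = diam ∸ 3

      p : Fin (6 + s)
      p = proj₁ (dist-split {x₀} {y₀} 2 (1 + t) (trans (sym diam≡3+) (sym dist-x₀y₀)))

      dist-x₀p : dist x₀ p ≡ 2
      dist-x₀p = proj₁ (proj₂ (dist-split {x₀} {y₀} 2 (1 + t) (trans (sym diam≡3+) (sym dist-x₀y₀))))

      dist-py₀ : dist p y₀ ≡ 1 + t
      dist-py₀ = proj₂ (proj₂ (dist-split {x₀} {y₀} 2 (1 + t) (trans (sym diam≡3+) (sym dist-x₀y₀))))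

      x₀≢p : ¬ x₀ ≡ p
      x₀≢p e = 0≢1+n (trans (sym (dist-refl x₀)) (trans (cong (dist x₀) e) dist-x₀p))

      y₀≢p : ¬ y₀ ≡ p
      y₀≢p e = 0≢1+n (trans (sym (dist-refl p)) (trans (cong (dist p) (sym e)) dist-py₀))

      FourthVertex : Set
      FourthVertex = ∃[ H ] (¬ x₀ ≡ H × ¬ y₀ ≡ H × ¬ p ≡ H × 1 ≤ excess p + excess H)

      fourth-vertex-inEcc : 3 ≤ inEcc p → FourthVertex
      fourth-vertex-inEcc 3≤in = H , x₀≢H , y₀≢H , p≢H , ≤-trans (1≤inEcc H) (≤-trans (inEcc≤excess-far H p r dist-Hp in-p) (≤-reflexive (+-comm (excess H) (excess p))))
        where
        r : ℕ
        r = inEcc p ∸ 3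
        in-p : inEcc p ≡ 3 + r
        in-p = sym (m+[n∸m]≡n 3≤in)
        H : Fin (6 + s)
        H = proj₁ (inEcc-attained p)
        dist-Hp : dist H p ≡ 3 + r
        dist-Hp = trans (proj₂ (inEcc-attained p)) in-p
        x₀≢H : ¬ x₀ ≡ H
        x₀≢H e = m≢1+m+n 2 (trans (sym dist-x₀p) (trans (cong (λ z → dist z p) e) dist-Hp))
        p≢H : ¬ p ≡ H
        p≢H e = 0≢1+n (trans (sym (dist-refl p)) (trans (cong (λ z → dist z p) e) dist-Hp))
        y₀≢H : ¬ y₀ ≡ H
        y₀≢H e = <⇒≱ 3≤diam (begin
          diam                      ≡⟨ sym dist-x₀y₀ ⟩
          dist x₀ y₀                ≤⟨ dist≤inEcc y₀ x₀ ⟩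
          inEcc y₀                  ≤⟨ inEcc≤excess-far y₀ p r (subst (λ z → dist z p ≡ 3 + r) (sym e) dist-Hp) in-p ⟩
          excess y₀ + excess p      ≤⟨ excess-pair≤2 y₀≢p ⟩
          2                         ∎)
          where open ≤-Reasoning

      fourth-vertex-outEcc : inEcc p < 3 → FourthVertex
      fourth-vertex-outEcc in<3 = H , x₀≢H , y₀≢H , p≢H , ≤-trans (1≤outEcc H) (outEcc≤excess-far p H r dist-pH out-p)
        where
        3≤out : 3 ≤ outEcc p
        3≤out = +-cancelʳ-≤ 2 3 (outEcc p) (≤-trans (≤-trans (m≤m+n 5 s) (rad p)) (+-monoʳ-≤ (outEcc p) (s≤s⁻¹ in<3)))
        r : ℕ
        r = outEcc p ∸ 3
        out-p : outEcc p ≡ 3 + r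
        out-p = sym (m+[n∸m]≡n 3≤out)
        H : Fin (6 + s)
        H = proj₁ (outEcc-attained p)
        dist-pH : dist p H ≡ 3 + r
        dist-pH = trans (proj₂ (outEcc-attained p)) out-p
        p≢H : ¬ p ≡ H
        p≢H e = 0≢1+n (trans (sym (dist-refl p)) (trans (cong (dist p) e) dist-pH))
        x₀≢H : ¬ x₀ ≡ H
        x₀≢H e = <⇒≱ 3≤diam (begin
          diam                      ≡⟨ sym outEcc-x₀ ⟩
          outEcc x₀                 ≤⟨ outEcc≤excess-far p x₀ r (subst (λ z → dist p z ≡ 3 + r) (sym e) dist-pH) out-p ⟩
          excess p + excess x₀      ≡⟨ +-comm (excess p) (excess x₀) ⟩
          excess x₀ + excess p      ≤⟨ excess-pair≤2 x₀≢p ⟩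
          2                         ∎)
          where open ≤-Reasoning
        y₀≢H : ¬ y₀ ≡ H
        y₀≢H e = <⇒≱ diam<k (begin
          5 + s                     ≤⟨ rad p ⟩
          outEcc p + inEcc p        ≤⟨ +-mono-≤ (≤-reflexive out-p≡1+t) (s≤s⁻¹ in<3) ⟩
          1 + t + 2                 ≡⟨ trans (+-comm (1 + t) 2) (sym diam≡3+) ⟩
          diam                      ∎)
          where
          open ≤-Reasoning
          out-p≡1+t : outEcc p ≡ 1 + t
          out-p≡1+t = trans out-p (trans (sym dist-pH) (trans (cong (dist p) (sym e)) dist-py₀))

      -- An extremal vertex for the larger eccentricity of p has positive excess together with p.
      fourth-vertex : FourthVertex
      fourth-vertex = [ fourth-vertex-inEcc , fourth-vertex-outEcc ]′ (≤-<-connex 3 (inEcc p))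

      excess-x₀+excess-y₀≤1 : excess x₀ + excess y₀ ≤ 1
      excess-x₀+excess-y₀≤1 = bound fourth-vertex
        where
        bound : FourthVertex → excess x₀ + excess y₀ ≤ 1
        bound (H , x₀≢H , y₀≢H , p≢H , 1≤pH) = +-cancelʳ-≤ 1 _ _ (begin
          excess x₀ + excess y₀ + 1                                       ≤⟨ +-monoʳ-≤ (excess x₀ + excess y₀) 1≤pH ⟩
          excess x₀ + excess y₀ + (excess p + excess H)                   ≡⟨ sym (+-assoc (excess x₀ + excess y₀) _ _) ⟩
          excess x₀ + excess y₀ + excess p + excess H                     ≤⟨ four≤sum excess x₀≢y₀ x₀≢p x₀≢H y₀≢p y₀≢H p≢H ⟩
          sum excess                                                      ≡⟨ sum≡2 ⟩
          2                                                               ∎)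
          where open ≤-Reasoning

      diam+inEcc+outEcc≤k+1 : diam + inEcc x₀ + outEcc y₀ ≤ 5 + s + 1
      diam+inEcc+outEcc≤k+1 = ≤-trans excess-diam-pair (≤-trans (+-monoˡ-≤ (5 + s) excess-x₀+excess-y₀≤1) (≤-reflexive (+-comm 1 (5 + s))))

      outEcc-y₀≡1 : outEcc y₀ ≡ 1
      outEcc-y₀≡1 = ≤-antisym (+-cancelˡ-≤ (5 + s) _ _ (≤-trans (+-monoˡ-≤ (outEcc y₀) 5+s≤diam+inEcc-x₀) diam+inEcc+outEcc≤k+1)) (1≤outEcc y₀)

      inEcc-x₀≡1 : inEcc x₀ ≡ 1
      inEcc-x₀≡1 = ≤-antisym (+-cancelˡ-≤ (5 + s) _ _ (begin
        5 + s + inEcc x₀                     ≤⟨ +-monoˡ-≤ (inEcc x₀) (≤-trans (rad y₀) (+-monoʳ-≤ (outEcc y₀) (inEcc≤diam y₀))) ⟩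
        outEcc y₀ + diam + inEcc x₀          ≡⟨ solve 3 (λ a d b → a :+ d :+ b := d :+ b :+ a) refl (outEcc y₀) diam (inEcc x₀) ⟩
        diam + inEcc x₀ + outEcc y₀          ≤⟨ diam+inEcc+outEcc≤k+1 ⟩
        5 + s + 1                            ∎)) (1≤inEcc x₀)
        where open ≤-Reasoning

      diam≡k-1 : diam ≡ 4 + s
      diam≡k-1 = ≤-antisym (s≤s⁻¹ (s≤s⁻¹ upper)) (s≤s⁻¹ lower)
        where
        open ≤-Reasoning
        upper : 2 + diam ≤ 6 + s
        upper = begin
          2 + diam                          ≡⟨ trans (+-comm 2 diam) (sym (+-assoc diam 1 1)) ⟩
          diam + 1 + 1                      ≡⟨ cong₂ (λ a b → diam + a + b) (sym inEcc-x₀≡1) (sym outEcc-y₀≡1) ⟩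
          diam + inEcc x₀ + outEcc y₀       ≤⟨ diam+inEcc+outEcc≤k+1 ⟩
          5 + s + 1                         ≡⟨ +-comm (5 + s) 1 ⟩
          6 + s                             ∎
        lower : 5 + s ≤ 1 + diam
        lower = ≤-trans 5+s≤diam+inEcc-x₀ (≤-reflexive (trans (cong (diam +_) inEcc-x₀≡1) (+-comm diam 1)))

    module AlmostHamiltonianGeodesic
      (x y : Fin (6 + s)) (dist-xy : dist x y ≡ 4 + s) (dist≤k-1 : ∀ u v → dist u v ≤ 4 + s)
      (inEcc-x : inEcc x ≡ 1) (outEcc-y : outEcc y ≡ 1) (excess-x : excess x ≡ 0) (1≤excess-y : 1 ≤ excess y) where

      nonOutDeg-x : nonOutDeg D x ≡ 3 + s
      nonOutDeg-x = +-cancelʳ-≡ 2 _ _ (begin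
        nonOutDeg D x + 2       ≡⟨ cong (_+ 2) (sym (trans (cong (nonOutDeg D x +_) (inEcc≤1⇒nonInDeg≡0 (≤-reflexive inEcc-x))) (+-identityʳ _))) ⟩
        nonDeg x + 2            ≡⟨ sym (excess+k x) ⟩
        excess x + (5 + s)      ≡⟨ cong (_+ (5 + s)) excess-x ⟩
        5 + s                   ≡⟨ +-comm 2 (3 + s) ⟩
        3 + s + 2               ∎)
        where open ≡-Reasoning

      outEcc-x : outEcc x ≡ 4 + s
      outEcc-x = ≤-antisym (outEcc-lub x (dist≤k-1 x)) (≤-trans (≤-reflexive (sym dist-xy)) (dist≤outEcc x y))

      -- The spheres of radius 3, …, k - 1 around x are nonempty, leaving room for only one
      -- vertex at distance 2 among the k - 2 non-out-neighbours of x.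
      unique-at-2 : ∀ {q q′} → dist x q ≡ 2 → dist x q′ ≡ 2 → q ≡ q′
      unique-at-2 {q} {q′} dq dq′ = decidable-stable (q ≟ᶠ q′) λ q≢q′ → <⇒≱ (n<1+n (3 + s)) (begin
        4 + s                          ≤⟨ +-mono-≤ (two-at-2 q≢q′) (farOut-below-outEcc x (1 + s) 3 (sym outEcc-x)) ⟩
        sphereOut x 2 + farOut x 3     ≡⟨ sym (farOut-suc x 2) ⟩
        farOut x 2                     ≤⟨ farOut-2≤nonOutDeg x ⟩
        nonOutDeg D x                  ≡⟨ nonOutDeg-x ⟩
        3 + s                          ∎)
        where
        open ≤-Reasoning
        open Layers D conn using (sphereOut; farOut)
        two-at-2 : ¬ q ≡ q′ → 2 ≤ sphereOut x 2
        two-at-2 q≢q′ = ≤-trans (≤-reflexive (sym (cong₂ _+_ (𝟙-yes (dist x q ≟ 2) dq) (𝟙-yes (dist x q′ ≟ 2) dq′))))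
                                (two≤sum (λ u → 𝟙 (dist x u ≟ 2)) q≢q′)

      p₂ : Fin (6 + s)
      p₂ = proj₁ (dist-split {x} {y} 2 (2 + s) (sym dist-xy))

      dist-xp₂ : dist x p₂ ≡ 2
      dist-xp₂ = proj₁ (proj₂ (dist-split {x} {y} 2 (2 + s) (sym dist-xy)))

      dist-to-x : ∀ v → dist v x ≤ 1
      dist-to-x v = ≤-trans (dist≤inEcc x v) (≤-reflexive inEcc-x)

      outEcc-p₂ : outEcc p₂ ≤ 2 + s
      outEcc-p₂ = outEcc-lub p₂ λ v → [ far v , near v ]′ (≤-<-connex 2 (dist x v))
        where
        via-p₂ : ∀ v → ∃[ q ] (dist x q ≡ 2 × dist q v ≡ dist x v ∸ 2) → dist p₂ v ≤ 2 + s
        via-p₂ v (q , dq , dqv) = begin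
          dist p₂ v         ≡⟨ cong (λ z → dist z v) (unique-at-2 dist-xp₂ dq) ⟩
          dist q v          ≡⟨ dqv ⟩
          dist x v ∸ 2      ≤⟨ ∸-monoˡ-≤ 2 (dist≤k-1 x v) ⟩
          2 + s             ∎
          where open ≤-Reasoning
        far : ∀ v → 2 ≤ dist x v → dist p₂ v ≤ 2 + s
        far v 2≤d = via-p₂ v (dist-split 2 (dist x v ∸ 2) (m+[n∸m]≡n 2≤d))
        near : ∀ v → dist x v < 2 → dist p₂ v ≤ 2 + s
        near v d<2 = ≤-trans (dist-triangle p₂ x v) (≤-trans (+-mono-≤ (dist-to-x p₂) (s≤s⁻¹ d<2)) (m≤m+n 2 s))

      inEcc-p₂ : inEcc p₂ ≡ 3
      inEcc-p₂ = ≤-antisym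
        (inEcc-lub p₂ λ v → ≤-trans (dist-triangle v x p₂) (+-mono-≤ (dist-to-x v) (≤-reflexive dist-xp₂)))
        (+-cancelˡ-≤ (2 + s) 3 _ (≤-trans (≤-reflexive (+-comm (2 + s) 3)) (≤-trans (rad p₂) (+-monoˡ-≤ (inEcc p₂) outEcc-p₂))))

      G : Fin (6 + s)
      G = proj₁ (inEcc-attained p₂)

      dist-Gp₂ : dist G p₂ ≡ 3
      dist-Gp₂ = trans (proj₂ (inEcc-attained p₂)) inEcc-p₂

      y≢G : ¬ y ≡ G
      y≢G e = <⇒≱ (s≤s (s≤s z≤n)) (≤-trans (≤-reflexive (sym dist-Gp₂))
        (≤-trans (≤-reflexive (cong (λ z → dist z p₂) (sym e))) (≤-trans (dist≤outEcc y p₂) (≤-reflexive outEcc-y))))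

      y≢p₂ : ¬ y ≡ p₂
      y≢p₂ e = m≢1+m+n 2 (trans (sym dist-xp₂) (trans (cong (dist x) (sym e)) dist-xy))

      G≢p₂ : ¬ G ≡ p₂
      G≢p₂ e = 0≢1+n (trans (sym (dist-refl p₂)) (trans (cong (λ z → dist z p₂) (sym e)) dist-Gp₂))

      x≢G : ¬ x ≡ G
      x≢G e = m≢1+m+n 2 (trans (sym dist-xp₂) (trans (cong (λ z → dist z p₂) e) dist-Gp₂))

      inEcc-G≤1 : inEcc G ≤ 1
      inEcc-G≤1 = ≤-trans (inEcc≤excess-far G p₂ 0 dist-Gp₂ inEcc-p₂) (+-cancelˡ-≤ 1 _ _ (begin
        1 + (excess G + excess p₂)               ≤⟨ +-monoˡ-≤ _ 1≤excess-y ⟩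
        excess y + (excess G + excess p₂)        ≡⟨ sym (+-assoc (excess y) _ _) ⟩
        excess y + excess G + excess p₂          ≤⟨ three≤sum excess y≢G y≢p₂ G≢p₂ ⟩
        sum excess                               ≡⟨ sum≡2 ⟩
        2                                        ∎))
        where open ≤-Reasoning

      outdeg-x : outdeg D x ≡ 2
      outdeg-x = +-cancelˡ-≡ (3 + s) _ _ (trans (cong (_+ outdeg D x) (sym nonOutDeg-x)) (trans (nonOutDeg+outdeg≡k D x) (+-comm 2 (3 + s))))

      p₁ : Fin (6 + s)
      p₁ = proj₁ (dist-split {x} {p₂} 1 1 (sym dist-xp₂))

      x→p₁ : adj D x p₁ ≡ true
      x→p₁ = dist≡1⇒adj (proj₁ (proj₂ (dist-split {x} {p₂} 1 1 (sym dist-xp₂))))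

      dist-p₁p₂ : dist p₁ p₂ ≡ 1
      dist-p₁p₂ = proj₂ (proj₂ (dist-split {x} {p₂} 1 1 (sym dist-xp₂)))

      G≢p₁ : ¬ G ≡ p₁
      G≢p₁ e = m≢1+m+n 1 (trans (sym dist-p₁p₂) (trans (cong (λ z → dist z p₂) (sym e)) dist-Gp₂))

      -- Every vertex has an arc to G; an out-neighbour w ≠ x of G would then be a third
      -- out-neighbour of x or a second vertex at distance 2 from x.
      G-only-to-x : ∀ {w} → adj D G w ≡ true → w ≡ x
      G-only-to-x {w} G→w = decidable-stable (w ≟ᶠ x) λ w≢x → by-dist w≢x (dist x w) refl
        where
        x→G : adj D x G ≡ true
        x→G = inEcc≤1⇒adj inEcc-G≤1 x≢G
        2≤dist-wp₂ : 2 ≤ dist w p₂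
        2≤dist-wp₂ = s≤s⁻¹ (≤-trans (≤-reflexive (sym dist-Gp₂)) (≤-trans (dist-triangle G w p₂) (+-monoˡ-≤ (dist w p₂) (adj⇒dist≤1 G→w))))
        G≢w : ¬ G ≡ w
        G≢w e = true≢false (trans (sym G→w) (trans (cong (adj D G) (sym e)) (loopless D G)))
        p₁≢w : ¬ p₁ ≡ w
        p₁≢w e = <⇒≱ (s≤s (s≤s z≤n)) (≤-trans 2≤dist-wp₂ (≤-reflexive (trans (cong (λ z → dist z p₂) (sym e)) dist-p₁p₂)))
        by-dist : ¬ w ≡ x → ∀ d → dist x w ≡ d → ⊥
        by-dist w≢x zero e = w≢x (sym (dist≡0⇒≡ e))
        by-dist w≢x (suc zero) e = <⇒≱ (s≤s (≤-reflexive outdeg-x)) (begin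
          3                                                          ≡⟨ cong₂ _+_ (cong₂ _+_ (cong χ (sym x→G)) (cong χ (sym x→p₁))) (cong χ (sym (dist≡1⇒adj e))) ⟩
          χ (adj D x G) + χ (adj D x p₁) + χ (adj D x w)             ≤⟨ three≤sum (χ ∘ adj D x) G≢p₁ G≢w p₁≢w ⟩
          outdeg D x                                                 ∎)
          where open ≤-Reasoning
        by-dist w≢x (suc (suc zero)) e = <⇒≱ (s≤s z≤n) (≤-trans 2≤dist-wp₂ (≤-reflexive (trans (cong (λ z → dist z p₂) (unique-at-2 e dist-xp₂)) (dist-refl p₂))))
        by-dist w≢x (suc (suc (suc d))) e = <⇒≱ (s≤s (s≤s (s≤s z≤n))) (≤-trans (≤-reflexive (sym e))
          (≤-trans (dist-triangle x G w) (+-mono-≤ (adj⇒dist≤1 x→G) (adj⇒dist≤1 G→w))))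

      absurd : ⊥
      absurd = via-x (dist-split {G} {y} 1 (dist G y ∸ 1) (m+[n∸m]≡n (≢⇒1≤dist (y≢G ∘ sym))))
        where
        via-x : ∃[ q ] (dist G q ≡ 1 × dist q y ≡ dist G y ∸ 1) → ⊥
        via-x (q , dGq , dqy) = <⇒≱ (s≤s (≤-reflexive (sym dist-xy))) (begin
          suc (dist x y)          ≡⟨ cong (λ z → suc (dist z y)) (sym (G-only-to-x (dist≡1⇒adj dGq))) ⟩
          suc (dist q y)          ≡⟨ cong suc dqy ⟩
          1 + (dist G y ∸ 1)      ≡⟨ m+[n∸m]≡n (≢⇒1≤dist (y≢G ∘ sym)) ⟩
          dist G y                ≤⟨ dist≤k-1 G y ⟩
          4 + s                   ∎)
          where open ≤-Reasoning

module Equality {s} (D : Digraph (6 + s)) (conn : StronglyConnected D)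
                (rad : ∀ v → 5 + s ≤ Distances.outEcc D conn v + Distances.inEcc D conn v) where
  open Reversal D conn using (module R; dist-reverse; outEcc-reverse; inEcc-reverse)
  module L = LargeRadius D conn rad

  rad-reverse : ∀ v → 5 + s ≤ R.outEcc v + R.inEcc v
  rad-reverse v = ≤-trans (rad v) (≤-reflexive (trans (+-comm (L.outEcc v) (L.inEcc v)) (sym (cong₂ _+_ (outEcc-reverse v) (inEcc-reverse v)))))

  module L′ = LargeRadius (reverse D) (reverse-stronglyConnected conn) rad-reverse

  excess-reverse : ∀ v → L′.excess v ≡ L.excess v
  excess-reverse v = cong (λ d → d + 2 ∸ (5 + s)) (+-comm (nonInDeg D v) (nonOutDeg D v))

  tight⇒diam≡k : sum L.excess ≡ 2 → L.diam ≡ 5 + s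
  tight⇒diam≡k sum≡2 = [ (λ diam<k → ⊥-elim (short diam<k)) , (λ diam≡k → diam≡k) ]′ (m≤n⇒m<n∨m≡n (L.Tight.diam≤k sum≡2))
    where
    short : L.diam < 5 + s → ⊥
    short diam<k = [ in-reverse , in-D ∘ n<1⇒n≡0 ]′ (≤-<-connex 1 (L.excess L.x₀))
      where
      open L.Tight.ShortDiameter sum≡2 diam<k
      dist-x₀y₀≡k-1 : L.dist L.x₀ L.y₀ ≡ 4 + s
      dist-x₀y₀≡k-1 = trans L.dist-x₀y₀ diam≡k-1
      dist≤k-1 : ∀ u v → L.dist u v ≤ 4 + s
      dist≤k-1 u v = ≤-trans (L.dist≤diam u v) (≤-reflexive diam≡k-1)
      in-D : L.excess L.x₀ ≡ 0 → ⊥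
      in-D excess-x₀≡0 = L.Tight.AlmostHamiltonianGeodesic.absurd sum≡2 L.x₀ L.y₀ dist-x₀y₀≡k-1 dist≤k-1
        inEcc-x₀≡1 outEcc-y₀≡1 excess-x₀≡0 (subst (λ e → 1 ≤ e + L.excess L.y₀) excess-x₀≡0 L.1≤excess-x₀+excess-y₀)
      in-reverse : 1 ≤ L.excess L.x₀ → ⊥
      in-reverse 1≤excess-x₀ = L′.Tight.AlmostHamiltonianGeodesic.absurd
        (trans (sum-cong-≗ excess-reverse) sum≡2) L.y₀ L.x₀
        (trans (dist-reverse L.y₀ L.x₀) dist-x₀y₀≡k-1)
        (λ u v → ≤-trans (≤-reflexive (dist-reverse u v)) (dist≤k-1 v u))
        (trans (inEcc-reverse L.y₀) outEcc-y₀≡1)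
        (trans (outEcc-reverse L.x₀) inEcc-x₀≡1)
        (trans (excess-reverse L.y₀) (n≤0⇒n≡0 (+-cancelˡ-≤ 1 _ 0 (≤-trans (+-monoˡ-≤ (L.excess L.y₀) 1≤excess-x₀) excess-x₀+excess-y₀≤1))))
        (≤-trans 1≤excess-x₀ (≤-reflexive (sym (excess-reverse L.x₀))))

injective⇒surjective : ∀ {n} {f : Fin n → Fin n} → Injective _≡_ _≡_ f → ∀ y → ∃[ x ] (f x ≡ y)
injective⇒surjective {n} {f} inj y with Fin.any? (λ x → f x ≟ᶠ y)
... | yes found = found
injective⇒surjective {suc n} {f} inj y | no ∄x = ⊥-elim (<-irrefl refl (Fin.injective⇒≤ punched-injective))
  where
  punched : Fin (suc n) → Fin n
  punched x = punchOut {i = y} {j = f x} (λ e → ∄x (x , sym e))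
  punched-injective : Injective _≡_ _≡_ punched
  punched-injective {a} {b} e = inj (Fin.punchOut-injective (λ e → ∄x (a , sym e)) (λ e → ∄x (b , sym e)) e)

injective⇒↔ : ∀ {n} (f : Fin n → Fin n) → Injective _≡_ _≡_ f → Fin n ↔ Fin n
injective⇒↔ f inj = mk↔ₛ′ f (proj₁ ∘ surjective) (proj₂ ∘ surjective) (λ x → inj (proj₂ (surjective (f x))))
  where
  surjective : ∀ y → ∃[ x ] (f x ≡ y)
  surjective = injective⇒surjective inj

sum-arcs-permute : ∀ {n} (D : Digraph n) (σ : Fin n ↔ Fin n) →
  arcs D ≡ sum (λ i → sum (λ j → χ (adj D (Inverse.to σ i) (Inverse.to σ j))))
sum-arcs-permute D σ = trans (arcs≡sum∑ D) (trans (∑-permute (λ u → sum (χ ∘ adj D u)) σ)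
  (sum-cong-≗ λ i → ∑-permute (χ ∘ adj D (Inverse.to σ i)) σ))

≅⇒arcs≡ : ∀ {n} (D E : Digraph n) → D ≅ E → arcs D ≡ arcs E
≅⇒arcs≡ D E (σ , adj≡) = trans (arcs≡sum∑ D) (trans (sum-cong-≗ λ u → sum-cong-≗ λ v → cong χ (adj≡ u v)) (sym (sum-arcs-permute E σ)))

module HamiltonianGeodesic {k} (D : Digraph (suc k)) (conn : StronglyConnected D)
                           {x y} (dist-xy : Distances.dist D conn x y ≡ k) where
  open Distances D conn

  private
    on-geodesic : ∀ (j : Fin (suc k)) → ∃[ q ] (dist x q ≡ toℕ j × dist q y ≡ k ∸ toℕ j)
    on-geodesic j = dist-split (toℕ j) (k ∸ toℕ j) (trans (m+[n∸m]≡n (Fin.toℕ≤pred[n] j)) (sym dist-xy))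

  π : Fin (suc k) → Fin (suc k)
  π j = proj₁ (on-geodesic j)

  dist-π : ∀ j → dist x (π j) ≡ toℕ j
  dist-π j = proj₁ (proj₂ (on-geodesic j))

  π-injective : Injective _≡_ _≡_ π
  π-injective {i} {j} e = Fin.toℕ-injective (trans (sym (dist-π i)) (trans (cong (dist x) e) (dist-π j)))

  σ : Fin (suc k) ↔ Fin (suc k)
  σ = injective⇒↔ π π-injective

  π-arc⇒GammaBar-arc : ∀ i j → adj D (π i) (π j) ≡ true → adj (GammaBar k) i j ≡ true
  π-arc⇒GammaBar-arc i j a with i ≟ᶠ j
  ... | yes refl = ⊥-elim (true≢false (trans (sym a) (loopless D (π i))))
  ... | no _ = Equivalence.to Bool.T-≡ (≤⇒≤ᵇ (begin
    toℕ j                       ≡⟨ sym (dist-π j) ⟩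
    dist x (π j)                ≤⟨ dist-triangle x (π i) (π j) ⟩
    dist x (π i) + dist (π i) (π j)  ≤⟨ +-mono-≤ (≤-reflexive (dist-π i)) (adj⇒dist≤1 a) ⟩
    toℕ i + 1                   ≡⟨ +-comm (toℕ i) 1 ⟩
    suc (toℕ i)                 ∎))
    where open ≤-Reasoning

  arcs≡⇒≅GammaBar : arcs D ≡ arcs (GammaBar k) → D ≅ GammaBar k
  arcs≡⇒≅GammaBar arcs≡ = ↔-sym σ , λ u v → trans (cong₂ (adj D) (sym (Inverse.strictlyInverseˡ σ u)) (sym (Inverse.strictlyInverseˡ σ v)))
                                                  (π-adj≡ (Inverse.from σ u) (Inverse.from σ v))
    where
    Γ : Digraph (suc k)
    Γ = GammaBar k
    pointwise : ∀ i j → χ (adj D (π i) (π j)) ≤ χ (adj Γ i j)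
    pointwise i j = χ-mono (π-arc⇒GammaBar-arc i j)
    rows≡ : ∀ i → sum (λ j → χ (adj D (π i) (π j))) ≡ sum (λ j → χ (adj Γ i j))
    rows≡ = sum-mono-≤-≡⇒≗ (sum-mono-≤ ∘ pointwise) (trans (sym (sum-arcs-permute D σ)) (trans arcs≡ (arcs≡sum∑ Γ)))
    π-adj≡ : ∀ i j → adj D (π i) (π j) ≡ adj Γ i j
    π-adj≡ i j = χ-injective (sum-mono-≤-≡⇒≗ (pointwise i) (rows≡ i) j)

count-≤ : ∀ n c → sum {n} (λ j → 𝟙 (toℕ j ≤? c)) ≡ n ⊓ suc c
count-≤ zero c = refl
count-≤ (suc n) zero = cong suc (begin
  sum {n} (λ j → 𝟙 (suc (toℕ j) ≤? 0))   ≡⟨ sum-cong-≗ {n} (λ j → 𝟙-no (suc (toℕ j) ≤? 0) λ ()) ⟩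
  sum {n} (const 0)                      ≡⟨ trans (sum-const n 0) (*-zeroʳ n) ⟩
  0                                      ≡⟨ sym (⊓-zeroʳ n) ⟩
  n ⊓ 0                                  ∎)
  where open ≡-Reasoning
count-≤ (suc n) (suc c) = cong suc (trans (sum-cong-≗ {n} λ j → shift (toℕ j)) (count-≤ n c))
  where
  shift : ∀ m → 𝟙 (suc m ≤? suc c) ≡ 𝟙 (m ≤? c)
  shift m with m ≤? c
  ... | yes m≤c = 𝟙-yes (suc m ≤? suc c) (s≤s m≤c)
  ... | no m≰c = 𝟙-no (suc m ≤? suc c) (m≰c ∘ s≤s⁻¹)

module GammaBarArcs (k : ℕ) where
  Γ : Digraph (suc k)
  Γ = GammaBar k

  outdeg-GammaBar : ∀ i → outdeg Γ i + 1 ≡ suc k ⊓ (2 + toℕ i)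
  outdeg-GammaBar i = begin
    outdeg Γ i + 1                        ≡⟨ cong₂ _+_ (sum-cong-≗ pointwise) (sym (𝟙-yes (toℕ i ≤? suc (toℕ i)) (n≤1+n _))) ⟩
    sum (updateAt below i (const 0)) + below i  ≡⟨ +-comm _ (below i) ⟩
    below i + sum (updateAt below i (const 0))  ≡⟨ sym (sum-updateAt-0 below i) ⟩
    sum below                             ≡⟨ count-≤ (suc k) (suc (toℕ i)) ⟩
    suc k ⊓ (2 + toℕ i)                   ∎
    where
    open ≡-Reasoning
    below : Fin (suc k) → ℕ
    below j = 𝟙 (toℕ j ≤? suc (toℕ i))
    pointwise : ∀ j → χ (adj Γ i j) ≡ updateAt below i (const 0) j
    pointwise j with i ≟ᶠ j
    ... | yes refl = sym (updateAt-updates i below)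
    ... | no i≢j = trans (sym (𝟙≡χ-does (toℕ j ≤? suc (toℕ i)))) (sym (updateAt-minimal j i below (i≢j ∘ sym)))

  arcs-GammaBar : arcs Γ ≡ sum {k} (λ i → 2 + toℕ i)
  arcs-GammaBar = +-cancelʳ-≡ (suc k) _ _ (begin
    arcs Γ + suc k                                ≡⟨ cong₂ _+_ (arcs≡sum-outdeg Γ) (sym (trans (sum-const (suc k) 1) (*-identityʳ _))) ⟩
    sum (outdeg Γ) + sum {suc k} (const 1)        ≡⟨ sym (∑-distrib-+ (outdeg Γ) (const 1)) ⟩
    sum (λ i → outdeg Γ i + 1)                    ≡⟨ sum-cong-≗ outdeg-GammaBar ⟩
    sum capped                                    ≡⟨ sum-init-last capped ⟩
    sum (capped ∘ inject₁) + capped (fromℕ k)     ≡⟨ cong₂ _+_ (sum-cong-≗ initial) final ⟩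
    sum {k} (λ i → 2 + toℕ i) + suc k             ∎)
    where
    open ≡-Reasoning
    capped : Fin (suc k) → ℕ
    capped i = suc k ⊓ (2 + toℕ i)
    initial : ∀ (i : Fin k) → capped (inject₁ i) ≡ 2 + toℕ i
    initial i rewrite Fin.toℕ-inject₁ i = m≥n⇒m⊓n≡n (s≤s (Fin.toℕ<n i))
    final : capped (fromℕ k) ≡ suc k
    final rewrite Fin.toℕ-fromℕ k = m≤n⇒m⊓n≡m (n≤1+n (suc k))

  double-sum-2+ : ∀ n → 2 * sum {n} (λ i → 2 + toℕ i) ≡ n * (n + 3)
  double-sum-2+ zero = refl
  double-sum-2+ (suc n) = begin
    2 * (2 + sum {n} (λ i → 2 + toℕ (suc i)))          ≡⟨ cong (λ z → 2 * (2 + z)) shift ⟩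
    2 * (2 + (n + sum {n} (λ i → 2 + toℕ i)))          ≡⟨ solve 2 (λ n a → con 2 :* (con 2 :+ (n :+ a)) := con 4 :+ con 2 :* n :+ con 2 :* a) refl n _ ⟩
    4 + 2 * n + 2 * sum {n} (λ i → 2 + toℕ i)          ≡⟨ cong (4 + 2 * n +_) (double-sum-2+ n) ⟩
    4 + 2 * n + n * (n + 3)                            ≡⟨ solve 1 (λ n → con 4 :+ con 2 :* n :+ n :* (n :+ con 3) := (con 1 :+ n) :* (con 1 :+ n :+ con 3)) refl n ⟩
    suc n * (suc n + 3)                                ∎
    where
    open ≡-Reasoning
    shift : sum {n} (λ i → 2 + toℕ (suc i)) ≡ n + sum {n} (λ i → 2 + toℕ i)
    shift = trans (∑-distrib-+ {n} (const 1) (λ i → 2 + toℕ i)) (cong (_+ sum {n} (λ i → 2 + toℕ i)) (trans (sum-const n 1) (*-identityʳ n)))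

  2*[arcs-GammaBar+1] : 2 * (arcs Γ + 1) ≡ (k + 1) * (k + 2)
  2*[arcs-GammaBar+1] = begin
    2 * (arcs Γ + 1)                            ≡⟨ cong (λ a → 2 * (a + 1)) arcs-GammaBar ⟩
    2 * (sum {k} (λ i → 2 + toℕ i) + 1)         ≡⟨ *-distribˡ-+ 2 (sum {k} (λ i → 2 + toℕ i)) 1 ⟩
    2 * sum {k} (λ i → 2 + toℕ i) + 2           ≡⟨ cong (_+ 2) (double-sum-2+ k) ⟩
    k * (k + 3) + 2                             ≡⟨ solve 1 (λ k → k :* (k :+ con 3) :+ con 2 := (k :+ con 1) :* (k :+ con 2)) refl k ⟩
    (k + 1) * (k + 2)                           ∎
    where open ≡-Reasoning

proposition4p6 : (k : ℕ) → 5 ≤ k → (D : Digraph (suc k)) → TwiceRadius D k →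
    (2 * (arcs D + 1) ≤ (k + 1) * (k + 2))
    × (2 * (arcs (GammaBar k) + 1) ≡ (k + 1) * (k + 2))
    × ((2 * (arcs D + 1) ≡ (k + 1) * (k + 2)) ⇔ (D ≅ GammaBar k))
proposition4p6 _ (s≤s (s≤s (s≤s (s≤s (s≤s (z≤n {s})))))) D twiceRadius =
  L.arcs-bound , 2*[arcs-GammaBar+1] , mk⇔ tight⇒≅ ≅⇒tight
  where
  open GammaBarArcs (5 + s) using (2*[arcs-GammaBar+1])
  conn : StronglyConnected D
  conn = twiceRadius⇒stronglyConnected twiceRadius
  rad : ∀ v → 5 + s ≤ Distances.outEcc D conn v + Distances.inEcc D conn v
  rad = Distances.twiceRadius⇒≤outEcc+inEcc D conn twiceRadius
  module L = LargeRadius D conn rad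

  tight⇒≅ : 2 * (arcs D + 1) ≡ (5 + s + 1) * (5 + s + 2) → D ≅ GammaBar (5 + s)
  tight⇒≅ tight = HamiltonianGeodesic.arcs≡⇒≅GammaBar D conn
    (trans L.dist-x₀y₀ (Equality.tight⇒diam≡k D conn rad (L.arcs-tight⇒sum-excess≡2 tight)))
    (+-cancelʳ-≡ 1 _ _ (*-cancelˡ-≡ _ _ 2 (trans tight (sym 2*[arcs-GammaBar+1]))))

  ≅⇒tight : D ≅ GammaBar (5 + s) → 2 * (arcs D + 1) ≡ (5 + s + 1) * (5 + s + 2)
  ≅⇒tight D≅Γ = trans (cong (λ a → 2 * (a + 1)) (≅⇒arcs≡ D (GammaBar (5 + s)) D≅Γ)) 2*[arcs-GammaBar+1]
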